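{- Assume a strongly regular graph $G$ with parameters $(1911,270,105,27)$ exists and has an induced quadrangle $x\sim u\sim y\sim v\sim x$. Let $U=\{u,v,w_1,w_2\}$ be an independent set of size $4$ in $\Delta(x)$. Then $c(u,v)\in\{24,25\}$ and $\sum_{\{u_1,u_2\}\subseteq U,\,u_1\neq u_2} c(u_1,u_2)\in\{154,155\}$, and one of the following holds: (1) $c(u,v)\in\{24,25\}$ and $\sum_{\{u_1,u_2\}} c(u_1,u_2)=154$; then either $c(u,v)=24$ and the other five pairs $\{u_1,u_2\}\neq\{u,v\}$ of $U$ all have $c(u_1,u_2)=26$, or $c(u,v)=25$, exactly one of the other five pairs has $c$-value $25$ and the remaining four have $c$-value $26$. Moreover, every vertex of $\Delta(x)$ has at most $2$ neighbours in $U$. (2) $c(u,v)=25$ and $\sum_{\{u_1,u_2\}} c(u_1,u_2)=155$; then all five pairs $\{u_1,u_2\}\neq\{u,v\}$ of $U$ have $c(u_1,u_2)=26$. In this case there is a unique vertex $z$ of $\Delta(x)$ with exactly $3$ neighbours in $U$, and every other vertex of $\Delta(x)$ has at most $2$ neighbours in $U$.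
   Context: A strongly regular graph with parameters $(n,k,\lambda,\mu)$ is a finite simple $k$-regular graph on $n$ vertices in which any two distinct adjacent vertices have exactly $\lambda$ common neighbours and any two distinct non-adjacent vertices have exactly $\mu$ common neighbours. An induced quadrangle $x\sim u\sim y\sim v\sim x$ means $x,u,y,v$ are distinct, $xu,uy,yv,vx$ are edges, and $x\not\sim y$, $u\not\sim v$. $\Delta(x)$ is the subgraph induced on the neighbours of $x$. For distinct non-adjacent vertices $w_1,w_2$ of $\Delta(x)$, $C(w_1,w_2)=\{z: z\sim x, z\sim w_1, z\sim w_2\}$ and $c(w_1,w_2)=|C(w_1,w_2)|$. The sum runs over the six $2$-element subsets of $U$. -}

module Defs where

import Agda.Primitive
open import Data.Nat using (ℕ; _≤_)
open import Data.Fin using (Fin)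
open import Data.List using (List; []; _∷_; length; filter; allFin)
open import Data.Product using (_×_; ∃-syntax)
open import Relation.Nullary using (¬_; Dec)
open import Relation.Binary.PropositionalEquality using (_≡_; _≢_)
open import Relation.Unary using (Pred)
import Relation.Unary as U

countP : ∀ {A : Set} {P : Pred A Agda.Primitive.lzero} → U.Decidable P → List A → ℕ
countP P? xs = length (filter P? xs)

record SimpleGraph (n : ℕ) : Set₁ where
  field
    _∼_    : Fin n → Fin n → Set
    _∼?_   : (a b : Fin n) → Dec (a ∼ b)
    ∼-sym  : ∀ {a b} → a ∼ b → b ∼ a
    ∼-irr  : ∀ {a} → ¬ (a ∼ a)

  commonNbrs : Fin n → Fin n → ℕ
  commonNbrs a b = countP (λ z → Dec-× (a ∼? z) (b ∼? z)) (allFin n)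
    where
    open import Relation.Nullary.Decidable using () renaming (_×-dec_ to Dec-×)

  degree : Fin n → ℕ
  degree a = countP (a ∼?_) (allFin n)

  -- c(w₁,w₂) relative to x: common neighbours of x, w₁, w₂
  cx : Fin n → Fin n → Fin n → ℕ
  cx x w₁ w₂ = countP (λ z → Dec-× (x ∼? z) (Dec-× (w₁ ∼? z) (w₂ ∼? z))) (allFin n)
    where
    open import Relation.Nullary.Decidable using () renaming (_×-dec_ to Dec-×)

  nbrsIn : Fin n → List (Fin n) → ℕ
  nbrsIn z us = countP (z ∼?_) us

record IsSRG {n : ℕ} (G : SimpleGraph n) (k l m : ℕ) : Set where
  open SimpleGraph G
  field
    regular : ∀ a → degree a ≡ k
    adjCommon : ∀ a b → a ≢ b → a ∼ b → commonNbrs a b ≡ l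
    nonadjCommon : ∀ a b → a ≢ b → ¬ (a ∼ b) → commonNbrs a b ≡ m

module Submission where

-- Double counting over Δ(x): if U lies in Δ(x) and N(z) is the number of neighbours of z in U,
-- then ∑ N(z) = λ|U| and ∑ C(N(z),2) = ∑ c over the pairs of U, the sums running over z ∈ Δ(x).
-- Hence ∑ (N(z) - 1)(N(z) - 2) = 2 ∑ c + 2k - 2λ|U|.  All terms are non-negative, and every
-- member of an independent U contributes 2, so |U|(λ + 1) ≤ ∑ c + k.  For |U| = 4 this gives
-- ∑ c ≥ 154, while c(u,v) ≤ μ - 2 = 25 (x and y are common neighbours of u, v outside Δ(x)) and
-- the other five values are ≤ μ - 1 = 26, so ∑ c ≤ 155.  The slack 2 ∑ c - 308 ∈ {0, 2} is the
-- contribution of Δ(x) ∖ U, which therefore has no vertex with 4 neighbours in U and at most one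
-- with 3.  A vertex of Δ(x) ∖ U with no neighbour in U would extend U to an independent 5-set,
-- forcing ∑ c ≥ 260 against ∑ c ≤ 4 · 26 + 155.

open import Defs
open import Data.Nat using (ℕ; zero; suc; _+_; _*_; _≤_; _<_; z≤n; s≤s)
open import Data.Nat.Properties
open import Data.Nat.Tactic.RingSolver using (solve-∀)
open import Data.Fin as Fin using (Fin)
open import Data.List using (List; []; _∷_; length; tabulate; map)
open import Data.Nat.ListAction using (sum)
open import Data.List.Properties using (map-cong; filter-all; filter-none; filter-accept; filter-reject)
open import Data.List.Membership.Propositional using (_∈_; _∉_)
open import Data.List.Relation.Unary.All as All using (All; []; _∷_)
open import Data.List.Relation.Unary.All.Properties using (¬Any⇒All¬; All¬⇒¬Any; map⁺)
open import Data.List.Relation.Unary.Any using (here; there)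
open import Data.List.Relation.Unary.AllPairs using (AllPairs; []; _∷_)
open import Data.List.Relation.Unary.Unique.Propositional using (Unique)
open import Data.Vec.Functional using (Vector; updateAt)
open import Data.Vec.Functional.Properties using (updateAt-updates; updateAt-minimal)
open import Data.Product using (_×_; _,_; ∃-syntax; proj₁; proj₂)
open import Data.Sum as Sum using (_⊎_; inj₁; inj₂; [_,_]′)
open import Data.Empty using (⊥-elim)
open import Function using (id; _∘_; const)
open import Relation.Nullary using (¬_; Dec; yes; no)
open import Relation.Nullary.Decidable using (_×-dec_; ¬?; from-no)
open import Relation.Binary.PropositionalEquality
open import Relation.Unary using (Pred)
open import Level using (0ℓ)
import Relation.Unary as U
open import Algebra.Properties.Semiring.Sum +-*-semiring
  using (sum-syntax; sum-replicate-zero; ∑-distrib-+; *-distribˡ-sum; sum-cong-≗)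
  renaming (sum to ∑)
open import Algebra.Properties.CommutativeSemigroup +-commutativeSemigroup using (x∙yz≈y∙xz)

𝟙 : ∀ {p} {P : Set p} → Dec P → ℕ
𝟙 (yes _) = 1
𝟙 (no _)  = 0

module _ {p} {P : Set p} where

  𝟙-yes : P → (d : Dec P) → 𝟙 d ≡ 1
  𝟙-yes _  (yes _) = refl
  𝟙-yes px (no ¬p) = ⊥-elim (¬p px)

  𝟙-idem : (d : Dec P) → 𝟙 d * 𝟙 d ≡ 𝟙 d
  𝟙-idem (yes _) = refl
  𝟙-idem (no _)  = refl

  𝟙+𝟙-¬? : (d : Dec P) → 𝟙 d + 𝟙 (¬? d) ≡ 1
  𝟙+𝟙-¬? (yes _) = refl
  𝟙+𝟙-¬? (no _)  = refl

module _ {p q} {P : Set p} {Q : Set q} where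

  𝟙-×-dec : (d : Dec P) (e : Dec Q) → 𝟙 (d ×-dec e) ≡ 𝟙 d * 𝟙 e
  𝟙-×-dec (yes _) (yes _) = refl
  𝟙-×-dec (yes _) (no _)  = refl
  𝟙-×-dec (no _)  _       = refl

  𝟙-cong : (P → Q) → (Q → P) → (d : Dec P) (e : Dec Q) → 𝟙 d ≡ 𝟙 e
  𝟙-cong _ _ (yes _) (yes _) = refl
  𝟙-cong _ _ (no _)  (no _)  = refl
  𝟙-cong f _ (yes p) (no ¬q) = ⊥-elim (¬q (f p))
  𝟙-cong _ g (no ¬p) (yes q) = ⊥-elim (¬p (g q))

module _ {A : Set} where

  pairSum : (A → A → ℕ) → List A → ℕ
  pairSum f []       = 0
  pairSum f (a ∷ as) = sum (map (f a) as) + pairSum f as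

  sum-map-const : ∀ {f : A → ℕ} {c xs} → All (λ a → f a ≡ c) xs → sum (map f xs) ≡ length xs * c
  sum-map-const []           = refl
  sum-map-const (fa≡c ∷ all) = cong₂ _+_ fa≡c (sum-map-const all)

  pairSum-cong : ∀ {f g : A → A → ℕ} → (∀ a b → f a b ≡ g a b) → ∀ xs → pairSum f xs ≡ pairSum g xs
  pairSum-cong f≡g []       = refl
  pairSum-cong f≡g (a ∷ as) = cong₂ _+_ (cong sum (map-cong (f≡g a) as)) (pairSum-cong f≡g as)

  *-distribˡ-sum-map : ∀ c (f : A → ℕ) xs → c * sum (map f xs) ≡ sum (map (λ a → c * f a) xs)
  *-distribˡ-sum-map c f []       = *-zeroʳ c
  *-distribˡ-sum-map c f (a ∷ as) =
    trans (*-distribˡ-+ c (f a) _) (cong (c * f a +_) (*-distribˡ-sum-map c f as))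

  *-distribˡ-pairSum : ∀ c (f : A → A → ℕ) xs → c * pairSum f xs ≡ pairSum (λ a b → c * f a b) xs
  *-distribˡ-pairSum c f []       = *-zeroʳ c
  *-distribˡ-pairSum c f (a ∷ as) = trans (*-distribˡ-+ c _ _)
    (cong₂ _+_ (*-distribˡ-sum-map c (f a) as) (*-distribˡ-pairSum c f as))

  ∑-sum-map : ∀ {n} (f : Fin n → A → ℕ) xs →
              ∑[ z < n ] sum (map (f z) xs) ≡ sum (map (λ a → ∑[ z < n ] f z a) xs)
  ∑-sum-map {n} f []   = sum-replicate-zero n
  ∑-sum-map f (a ∷ as) = trans (∑-distrib-+ (λ z → f z a) _) (cong (_ +_) (∑-sum-map f as))

  ∑-pairSum : ∀ {n} (f : Fin n → A → A → ℕ) xs →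
              ∑[ z < n ] pairSum (f z) xs ≡ pairSum (λ a b → ∑[ z < n ] f z a b) xs
  ∑-pairSum {n} f []   = sum-replicate-zero n
  ∑-pairSum f (a ∷ as) = trans (∑-distrib-+ (λ z → sum (map (f z a) as)) _)
    (cong₂ _+_ (∑-sum-map (λ z → f z a) as) (∑-pairSum f as))

module _ {A : Set} {P : Pred A 0ℓ} (P? : U.Decidable P) where

  countP-∷ : ∀ x xs → countP P? (x ∷ xs) ≡ 𝟙 (P? x) + countP P? xs
  countP-∷ x xs with P? x
  ... | yes _ = refl
  ... | no _  = refl

  countP≡sum : ∀ xs → countP P? xs ≡ sum (map (𝟙 ∘ P?) xs)
  countP≡sum []       = refl
  countP≡sum (x ∷ xs) = trans (countP-∷ x xs) (cong (𝟙 (P? x) +_) (countP≡sum xs))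

  countP-tabulate : ∀ {m} (f : Fin m → A) → countP P? (tabulate f) ≡ ∑[ i < m ] 𝟙 (P? (f i))
  countP-tabulate {zero}  f = refl
  countP-tabulate {suc m} f =
    trans (countP-∷ (f Fin.zero) _) (cong (𝟙 (P? (f Fin.zero)) +_) (countP-tabulate (f ∘ Fin.suc)))

  countP-all : ∀ {xs} → All P xs → countP P? xs ≡ length xs
  countP-all all = cong length (filter-all P? all)

  countP≡0⇒All¬ : ∀ xs → countP P? xs ≡ 0 → All (¬_ ∘ P) xs
  countP≡0⇒All¬ []       _ = []
  countP≡0⇒All¬ (x ∷ xs) c with P? x
  ... | no ¬px = ¬px ∷ countP≡0⇒All¬ xs c

  countP-square : ∀ xs → countP P? xs * countP P? xs ≡ countP P? xs + 2 * pairSum (λ a b → 𝟙 (P? a) * 𝟙 (P? b)) xs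
  countP-square []       = refl
  countP-square (x ∷ xs) = begin
    countP P? (x ∷ xs) * countP P? (x ∷ xs) ≡⟨ cong (λ c → c * c) (countP-∷ x xs) ⟩
    (d + N) * (d + N)                        ≡⟨ expand d N ⟩
    d * d + N * N + 2 * (d * N)              ≡⟨ cong₂ (λ s t → s + t + 2 * (d * N)) (𝟙-idem (P? x)) (countP-square xs) ⟩
    d + (N + 2 * Q) + 2 * (d * N)            ≡⟨ regroup d N Q ⟩
    (d + N) + 2 * (d * N + Q)                ≡⟨ cong₂ (λ s t → s + 2 * (t + Q)) (sym (countP-∷ x xs)) pairs-with-x ⟩
    countP P? (x ∷ xs) + 2 * pairSum (λ a b → 𝟙 (P? a) * 𝟙 (P? b)) (x ∷ xs) ∎
    where
    open ≡-Reasoning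
    d N Q : ℕ
    d = 𝟙 (P? x)
    N = countP P? xs
    Q = pairSum (λ a b → 𝟙 (P? a) * 𝟙 (P? b)) xs
    expand : ∀ d N → (d + N) * (d + N) ≡ d * d + N * N + 2 * (d * N)
    expand = solve-∀
    regroup : ∀ d N Q → d + (N + 2 * Q) + 2 * (d * N) ≡ (d + N) + 2 * (d * N + Q)
    regroup = solve-∀
    pairs-with-x : d * N ≡ sum (map (λ b → d * 𝟙 (P? b)) xs)
    pairs-with-x = trans (cong (d *_) (countP≡sum xs)) (*-distribˡ-sum-map d (𝟙 ∘ P?) xs)

≤-∑ : ∀ {n} (t : Vector ℕ n) (z : Fin n) → t z ≤ ∑ t
≤-∑ t Fin.zero    = m≤m+n (t Fin.zero) _
≤-∑ t (Fin.suc z) = ≤-trans (≤-∑ (t ∘ Fin.suc) z) (m≤n+m _ (t Fin.zero))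

∑-pos⇒∃ : ∀ {n} (t : Vector ℕ n) → 0 < ∑ t → ∃[ z ] 0 < t z
∑-pos⇒∃ {suc n} t pos with t Fin.zero in eq
... | suc _ = Fin.zero , subst (0 <_) (sym eq) (s≤s z≤n)
... | zero  = let z , tz = ∑-pos⇒∃ (t ∘ Fin.suc) pos in Fin.suc z , tz

∑-updateAt-0 : ∀ {n} (t : Vector ℕ n) (p : Fin n) → ∑ t ≡ t p + ∑ (updateAt t p (const 0))
∑-updateAt-0 t Fin.zero    = refl
∑-updateAt-0 t (Fin.suc p) = begin
  t₀ + ∑ (t ∘ Fin.suc)                                          ≡⟨ cong (t₀ +_) (∑-updateAt-0 (t ∘ Fin.suc) p) ⟩
  t₀ + (t (Fin.suc p) + ∑ (updateAt (t ∘ Fin.suc) p (const 0))) ≡⟨ x∙yz≈y∙xz t₀ (t (Fin.suc p)) _ ⟩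
  t (Fin.suc p) + (t₀ + ∑ (updateAt (t ∘ Fin.suc) p (const 0))) ∎
  where
  open ≡-Reasoning
  t₀ : ℕ
  t₀ = t Fin.zero

erase : ∀ {n} → List (Fin n) → Vector ℕ n → Vector ℕ n
erase []       t = t
erase (p ∷ ps) t = updateAt (erase ps t) p (const 0)

module _ {n : ℕ} where

  erase-∉ : ∀ {z : Fin n} ps t → z ∉ ps → erase ps t z ≡ t z
  erase-∉ []       t _  = refl
  erase-∉ (p ∷ ps) t z∉ =
    trans (updateAt-minimal _ p (erase ps t) (z∉ ∘ here)) (erase-∉ ps t (z∉ ∘ there))

  erase-∈ : ∀ {z : Fin n} ps t → z ∈ ps → erase ps t z ≡ 0
  erase-∈ (p ∷ ps) t (here refl) = updateAt-updates p (erase ps t)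
  erase-∈ {z} (p ∷ ps) t (there z∈ps) with z Fin.≟ p
  ... | yes refl = updateAt-updates p (erase ps t)
  ... | no z≢p   = trans (updateAt-minimal z p (erase ps t) z≢p) (erase-∈ ps t z∈ps)

  ∑-erase : ∀ {ps : List (Fin n)} → Unique ps → (t : Vector ℕ n) → ∑ t ≡ sum (map t ps) + ∑ (erase ps t)
  ∑-erase [] t = refl
  ∑-erase {p ∷ ps} (p∉ps ∷ ps!) t = begin
    ∑ t                       ≡⟨ ∑-erase ps! t ⟩
    σ + ∑ (erase ps t)        ≡⟨ cong (σ +_) (∑-updateAt-0 (erase ps t) p) ⟩
    σ + (erase ps t p + ρ)    ≡⟨ cong (λ e → σ + (e + ρ)) (erase-∉ ps t (All¬⇒¬Any p∉ps)) ⟩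
    σ + (t p + ρ)             ≡⟨ x∙yz≈y∙xz σ (t p) ρ ⟩
    t p + (σ + ρ)             ≡⟨ +-assoc (t p) σ ρ ⟨
    t p + σ + ρ               ∎
    where
    open ≡-Reasoning
    σ ρ : ℕ
    σ = sum (map t ps)
    ρ = ∑ (erase (p ∷ ps) t)

  sum-map≤∑ : ∀ {ps : List (Fin n)} → Unique ps → (t : Vector ℕ n) → sum (map t ps) ≤ ∑ t
  sum-map≤∑ ps! t = ≤-trans (m≤m+n _ _) (≤-reflexive (sym (∑-erase ps! t)))

-- (n - 1)(n - 2) on ℕ, without truncated subtraction
φ : ℕ → ℕ
φ 0             = 2
φ 1             = 0
φ (suc (suc k)) = suc k * k

φ+3*n≡n*n+2 : ∀ n → φ n + 3 * n ≡ n * n + 2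
φ+3*n≡n*n+2 0             = refl
φ+3*n≡n*n+2 1             = refl
φ+3*n≡n*n+2 (suc (suc k)) = expand k
  where
  expand : ∀ k → (1 + k) * k + 3 * (2 + k) ≡ (2 + k) * (2 + k) + 2
  expand = solve-∀

φ-pos : ∀ n → 0 < φ n → n ≡ 0 ⊎ 3 ≤ n
φ-pos 0                   _ = inj₁ refl
φ-pos (suc (suc (suc _))) _ = inj₂ (s≤s (s≤s (s≤s z≤n)))

2≤φ : ∀ {n} → 3 ≤ n → 2 ≤ φ n
2≤φ {1}                   (s≤s ())
2≤φ {2}                   (s≤s (s≤s ()))
2≤φ {suc (suc (suc k))} _ = *-mono-≤ {2} {2 + k} {1} {1 + k} (s≤s (s≤s z≤n)) (s≤s z≤n)

6≤φ : ∀ {n} → 4 ≤ n → 6 ≤ φ n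
6≤φ {1}                         (s≤s ())
6≤φ {2}                         (s≤s (s≤s ()))
6≤φ {3}                         (s≤s (s≤s (s≤s ())))
6≤φ {suc (suc (suc (suc k)))} _ = *-mono-≤ {3} {3 + k} {2} {2 + k} (s≤s (s≤s (s≤s z≤n))) (s≤s (s≤s z≤n))

module _ {A : Set} {P : Pred A 0ℓ} (P? : U.Decidable P) where

  φ-countP : ∀ xs → φ (countP P? xs) + 2 * countP P? xs ≡ 2 * pairSum (λ a b → 𝟙 (P? a) * 𝟙 (P? b)) xs + 2
  φ-countP xs = +-cancelʳ-≡ N _ _ (begin
    φ N + 2 * N + N       ≡⟨ regroup (φ N) N ⟩
    φ N + 3 * N           ≡⟨ φ+3*n≡n*n+2 N ⟩
    N * N + 2             ≡⟨ cong (_+ 2) (countP-square P? xs) ⟩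
    N + 2 * Q + 2         ≡⟨ rotate N Q ⟩
    2 * Q + 2 + N         ∎)
    where
    open ≡-Reasoning
    N Q : ℕ
    N = countP P? xs
    Q = pairSum (λ a b → 𝟙 (P? a) * 𝟙 (P? b)) xs
    regroup : ∀ a N → a + 2 * N + N ≡ a + 3 * N
    regroup = solve-∀
    rotate : ∀ N Q → N + 2 * Q + 2 ≡ 2 * Q + 2 + N
    rotate = solve-∀

+-tight : ∀ {x y m k} → x ≤ m → y ≤ k → x + y ≡ m + k → x ≡ m × y ≡ k
+-tight {x} {y} {m} {k} x≤m y≤k eq =
  ≤-antisym x≤m (+-cancelʳ-≤ k m x (≤-trans (≤-reflexive (sym eq)) (+-monoʳ-≤ x y≤k))) ,
  ≤-antisym y≤k (+-cancelˡ-≤ m k y (≤-trans (≤-reflexive (sym eq)) (+-monoˡ-≤ y x≤m)))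

+-tight-but-one : ∀ {x y m k} → x ≤ m → y ≤ k → suc (x + y) ≡ m + k →
                  (x ≡ m × suc y ≡ k) ⊎ (suc x ≡ m × y ≡ k)
+-tight-but-one {x} {y} {m} {k} x≤m y≤k eq with x ≟ m
... | yes refl = inj₁ (refl , +-cancelˡ-≡ x _ _ (trans (+-suc x y) eq))
... | no x≢m   = inj₂ (+-tight (≤∧≢⇒< x≤m x≢m) y≤k eq)

sum≤length* : ∀ {b xs} → All (_≤ b) xs → sum xs ≤ length xs * b
sum≤length* []           = z≤n
sum≤length* (x≤b ∷ xs≤b) = +-mono-≤ x≤b (sum≤length* xs≤b)

sum≡length*⇒All≡ : ∀ {b xs} → All (_≤ b) xs → sum xs ≡ length xs * b → All (_≡ b) xs
sum≡length*⇒All≡ []           _  = []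
sum≡length*⇒All≡ (x≤b ∷ xs≤b) eq =
  let x≡b , eq′ = +-tight x≤b (sum≤length* xs≤b) eq in x≡b ∷ sum≡length*⇒All≡ xs≤b eq′

suc-sum≡length*⇒ : ∀ {b xs} → All (_≤ suc b) xs → suc (sum xs) ≡ length xs * suc b →
                   countP (_≟ b) xs ≡ 1 × suc (countP (_≟ suc b) xs) ≡ length xs
suc-sum≡length*⇒ {b} {x ∷ xs} (x≤ ∷ xs≤) eq with +-tight-but-one x≤ (sum≤length* xs≤) eq
... | inj₁ (refl , eq′) =
  let one , rest = suc-sum≡length*⇒ xs≤ eq′ in
  trans (cong length (filter-reject (_≟ b) 1+n≢n)) one ,
  cong suc (trans (cong length (filter-accept (_≟ suc b) refl)) rest)
... | inj₂ (refl , eq′) =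
  let all≡ = sum≡length*⇒All≡ xs≤ eq′ in
  trans (cong length (filter-accept (_≟ b) refl))
        (cong suc (cong length (filter-none (_≟ b) (All.map (λ { refl → 1+n≢n }) all≡)))) ,
  cong suc (trans (cong length (filter-reject (_≟ suc b) (1+n≢n ∘ sym))) (countP-all (_≟ suc b) all≡))

module _ {n : ℕ} (G : SimpleGraph n) where
  open SimpleGraph G

  ∼⇒≢ : ∀ {a b} → a ∼ b → a ≢ b
  ∼⇒≢ a∼b refl = ∼-irr a∼b

  Independent : List (Fin n) → Set
  Independent = AllPairs (λ a b → ¬ a ∼ b)

  defect : Fin n → List (Fin n) → Vector ℕ n
  defect x us z = 𝟙 (x ∼? z) * φ (nbrsIn z us)

  cSum : Fin n → List (Fin n) → ℕ
  cSum x = pairSum (cx x)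

  Independent⇒All≁ : ∀ {a us} → Independent us → a ∈ us → All (λ b → ¬ a ∼ b) us
  Independent⇒All≁ (a≁bs ∷ _)   (here refl)  = ∼-irr ∷ a≁bs
  Independent⇒All≁ (b≁bs ∷ bs!) (there a∈bs) =
    (λ a∼b → All.lookup b≁bs a∈bs (∼-sym a∼b)) ∷ Independent⇒All≁ bs! a∈bs

  nbrsIn≡0 : ∀ {a us} → All (λ b → ¬ a ∼ b) us → nbrsIn a us ≡ 0
  nbrsIn≡0 {a} a≁us = cong length (filter-none (a ∼?_) a≁us)

  𝟙-∼-comm : ∀ a b → 𝟙 (a ∼? b) ≡ 𝟙 (b ∼? a)
  𝟙-∼-comm a b = 𝟙-cong ∼-sym ∼-sym (a ∼? b) (b ∼? a)

  commonNbrs≡∑ : ∀ a b → commonNbrs a b ≡ ∑[ z < n ] (𝟙 (a ∼? z) * 𝟙 (b ∼? z))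
  commonNbrs≡∑ a b = trans (countP-tabulate (λ z → (a ∼? z) ×-dec (b ∼? z)) {n} id)
    (sum-cong-≗ λ z → 𝟙-×-dec (a ∼? z) (b ∼? z))

  cx≡∑ : ∀ x a b → cx x a b ≡ ∑[ z < n ] (𝟙 (x ∼? z) * (𝟙 (a ∼? z) * 𝟙 (b ∼? z)))
  cx≡∑ x a b = trans (countP-tabulate (λ z → (x ∼? z) ×-dec ((a ∼? z) ×-dec (b ∼? z))) {n} id)
    (sum-cong-≗ λ z → trans (𝟙-×-dec (x ∼? z) _) (cong (𝟙 (x ∼? z) *_) (𝟙-×-dec (a ∼? z) (b ∼? z))))

  cx+length≤commonNbrs : ∀ {x a b ps} → Unique ps → All (λ z → ¬ x ∼ z × a ∼ z × b ∼ z) ps →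
                         cx x a b + length ps ≤ commonNbrs a b
  cx+length≤commonNbrs {x} {a} {b} {ps} ps! outside = begin
    cx x a b + length ps                ≡⟨ cong (cx x a b +_) (trans (sym (*-identityʳ _)) (sym ones)) ⟩
    cx x a b + sum (map r ps)           ≤⟨ +-monoʳ-≤ (cx x a b) (sum-map≤∑ ps! r) ⟩
    cx x a b + ∑ r                      ≡⟨ cong (_+ ∑ r) (cx≡∑ x a b) ⟩
    ∑[ z < n ] (𝟙 (x ∼? z) * q z) + ∑ r ≡⟨ ∑-distrib-+ (λ z → 𝟙 (x ∼? z) * q z) r ⟨
    ∑[ z < n ] (𝟙 (x ∼? z) * q z + r z) ≡⟨ sum-cong-≗ split ⟩
    ∑ q                                 ≡⟨ commonNbrs≡∑ a b ⟨
    commonNbrs a b                      ∎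
    where
    open ≤-Reasoning
    q r : Vector ℕ n
    q z = 𝟙 (a ∼? z) * 𝟙 (b ∼? z)
    r z = 𝟙 (¬? (x ∼? z)) * q z
    split : ∀ z → 𝟙 (x ∼? z) * q z + r z ≡ q z
    split z = trans (sym (*-distribʳ-+ (q z) (𝟙 (x ∼? z)) _))
                    (trans (cong (_* q z) (𝟙+𝟙-¬? (x ∼? z))) (*-identityˡ (q z)))
    ones : sum (map r ps) ≡ length ps * 1
    ones = sum-map-const (All.map r≡1 outside)
      where
      r≡1 : ∀ {z} → ¬ x ∼ z × a ∼ z × b ∼ z → r z ≡ 1
      r≡1 {z} (x≁z , a∼z , b∼z) =
        cong₂ _*_ (𝟙-yes x≁z (¬? (x ∼? z))) (cong₂ _*_ (𝟙-yes a∼z (a ∼? z)) (𝟙-yes b∼z (b ∼? z)))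

  ∑-pairs : ∀ x us → ∑[ z < n ] (𝟙 (x ∼? z) * pairSum (λ a b → 𝟙 (z ∼? a) * 𝟙 (z ∼? b)) us) ≡ cSum x us
  ∑-pairs x us = begin
    ∑[ z < n ] (𝟙 (x ∼? z) * pairSum (λ a b → 𝟙 (z ∼? a) * 𝟙 (z ∼? b)) us)
      ≡⟨ sum-cong-≗ (λ z → *-distribˡ-pairSum (𝟙 (x ∼? z)) _ us) ⟩
    ∑[ z < n ] pairSum (λ a b → 𝟙 (x ∼? z) * (𝟙 (z ∼? a) * 𝟙 (z ∼? b))) us
      ≡⟨ ∑-pairSum (λ z a b → 𝟙 (x ∼? z) * (𝟙 (z ∼? a) * 𝟙 (z ∼? b))) us ⟩
    pairSum (λ a b → ∑[ z < n ] (𝟙 (x ∼? z) * (𝟙 (z ∼? a) * 𝟙 (z ∼? b)))) us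
      ≡⟨ pairSum-cong (λ a b → sym (trans (cx≡∑ x a b) (sum-cong-≗ (flip a b)))) us ⟩
    cSum x us ∎
    where
    open ≡-Reasoning
    flip : ∀ a b z → 𝟙 (x ∼? z) * (𝟙 (a ∼? z) * 𝟙 (b ∼? z)) ≡ 𝟙 (x ∼? z) * (𝟙 (z ∼? a) * 𝟙 (z ∼? b))
    flip a b z = cong (𝟙 (x ∼? z) *_) (cong₂ _*_ (𝟙-∼-comm a z) (𝟙-∼-comm b z))

  defect-Δ : ∀ {x z} us → x ∼ z → defect x us z ≡ φ (nbrsIn z us)
  defect-Δ {x} {z} us x∼z = trans (cong (_* φ (nbrsIn z us)) (𝟙-yes x∼z (x ∼? z))) (*-identityˡ _)

  defect-pos : ∀ {x z} us → 0 < defect x us z → x ∼ z × 0 < φ (nbrsIn z us)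
  defect-pos {x} {z} us pos with x ∼? z
  ... | yes x∼z = x∼z , subst (0 <_) (+-identityʳ _) pos

  defect-independent : ∀ {x us} → All (x ∼_) us → Independent us → sum (map (defect x us) us) ≡ length us * 2
  defect-independent {x} {us} x∼us us-indep = sum-map-const (All.tabulate defect≡2)
    where
    defect≡2 : ∀ {a} → a ∈ us → defect x us a ≡ 2
    defect≡2 {a} a∈us = cong₂ (λ s t → s * φ t)
      (𝟙-yes (All.lookup x∼us a∈us) (x ∼? a)) (nbrsIn≡0 (Independent⇒All≁ us-indep a∈us))

  module _ {k l μ} (srg : IsSRG G k l μ) where
    open IsSRG srg

    cx<μ : ∀ {x a b} → a ≢ b → ¬ a ∼ b → x ∼ a → x ∼ b → cx x a b < μ
    cx<μ {x} {a} {b} a≢b a≁b x∼a x∼b = subst (_≤ μ) (+-comm (cx x a b) 1) (≤-trans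
      (cx+length≤commonNbrs ([] ∷ []) ((∼-irr , ∼-sym x∼a , ∼-sym x∼b) ∷ []))
      (≤-reflexive (nonadjCommon a b a≢b a≁b)))

    cx+2≤μ : ∀ {x y a b} → a ≢ b → ¬ a ∼ b → x ∼ a → x ∼ b → x ≢ y → ¬ x ∼ y → a ∼ y → b ∼ y →
             cx x a b + 2 ≤ μ
    cx+2≤μ a≢b a≁b x∼a x∼b x≢y x≁y a∼y b∼y = ≤-trans
      (cx+length≤commonNbrs ((x≢y ∷ []) ∷ [] ∷ []) ((∼-irr , ∼-sym x∼a , ∼-sym x∼b) ∷ (x≁y , a∼y , b∼y) ∷ []))
      (≤-reflexive (nonadjCommon _ _ a≢b a≁b))

    ∑-nbrsIn : ∀ {x us} → All (x ∼_) us → ∑[ z < n ] (𝟙 (x ∼? z) * nbrsIn z us) ≡ length us * l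
    ∑-nbrsIn {x} [] = trans (sum-cong-≗ (λ z → *-zeroʳ (𝟙 (x ∼? z)))) (sum-replicate-zero n)
    ∑-nbrsIn {x} {a ∷ as} (x∼a ∷ x∼as) = begin
      ∑[ z < n ] (𝟙 (x ∼? z) * nbrsIn z (a ∷ as))
        ≡⟨ sum-cong-≗ (λ z → trans (cong (𝟙 (x ∼? z) *_) (countP-∷ (z ∼?_) a as)) (*-distribˡ-+ (𝟙 (x ∼? z)) _ _)) ⟩
      ∑[ z < n ] (𝟙 (x ∼? z) * 𝟙 (z ∼? a) + 𝟙 (x ∼? z) * nbrsIn z as)
        ≡⟨ ∑-distrib-+ (λ z → 𝟙 (x ∼? z) * 𝟙 (z ∼? a)) _ ⟩
      ∑[ z < n ] (𝟙 (x ∼? z) * 𝟙 (z ∼? a)) + ∑[ z < n ] (𝟙 (x ∼? z) * nbrsIn z as)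
        ≡⟨ cong₂ _+_ common (∑-nbrsIn x∼as) ⟩
      l + length as * l ∎
      where
      open ≡-Reasoning
      common : ∑[ z < n ] (𝟙 (x ∼? z) * 𝟙 (z ∼? a)) ≡ l
      common = trans (sum-cong-≗ (λ z → cong (𝟙 (x ∼? z) *_) (𝟙-∼-comm z a)))
                     (trans (sym (commonNbrs≡∑ x a)) (adjCommon x a (∼⇒≢ x∼a) x∼a))

    ∑-defect : ∀ {x us} → All (x ∼_) us → ∑ (defect x us) + 2 * (length us * l) ≡ 2 * cSum x us + 2 * k
    ∑-defect {x} {us} x∼us = begin
      ∑ D + 2 * (length us * l)                     ≡⟨ cong (λ s → ∑ D + 2 * s) (∑-nbrsIn x∼us) ⟨
      ∑ D + 2 * ∑[ z < n ] (𝟙x z * N z)             ≡⟨ cong (∑ D +_) (*-distribˡ-sum 2 (λ z → 𝟙x z * N z)) ⟩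
      ∑ D + ∑[ z < n ] (2 * (𝟙x z * N z))           ≡⟨ ∑-distrib-+ D (λ z → 2 * (𝟙x z * N z)) ⟨
      ∑[ z < n ] (D z + 2 * (𝟙x z * N z))           ≡⟨ sum-cong-≗ (λ z → scale (𝟙x z) (φ-countP (z ∼?_) us)) ⟩
      ∑[ z < n ] (2 * (𝟙x z * Q z) + 2 * 𝟙x z)      ≡⟨ ∑-distrib-+ (λ z → 2 * (𝟙x z * Q z)) (λ z → 2 * 𝟙x z) ⟩
      ∑[ z < n ] (2 * (𝟙x z * Q z)) + ∑[ z < n ] (2 * 𝟙x z)
        ≡⟨ cong₂ _+_ (*-distribˡ-sum 2 (λ z → 𝟙x z * Q z)) (*-distribˡ-sum 2 𝟙x) ⟨
      2 * ∑[ z < n ] (𝟙x z * Q z) + 2 * ∑ 𝟙x       ≡⟨ cong₂ (λ s t → 2 * s + 2 * t) (∑-pairs x us) degree≡k ⟩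
      2 * cSum x us + 2 * k                          ∎
      where
      open ≡-Reasoning
      D 𝟙x N Q : Vector ℕ n
      D = defect x us
      𝟙x z = 𝟙 (x ∼? z)
      N z = nbrsIn z us
      Q z = pairSum (λ a b → 𝟙 (z ∼? a) * 𝟙 (z ∼? b)) us
      degree≡k : ∑ 𝟙x ≡ k
      degree≡k = trans (sym (countP-tabulate (x ∼?_) {n} id)) (regular x)
      scale : ∀ d {a N Q} → a + 2 * N ≡ 2 * Q + 2 → d * a + 2 * (d * N) ≡ 2 * (d * Q) + 2 * d
      scale d {a} {N} {Q} eq = begin
        d * a + 2 * (d * N) ≡⟨ gather d a N ⟩
        d * (a + 2 * N)     ≡⟨ cong (d *_) eq ⟩
        d * (2 * Q + 2)     ≡⟨ distribute d Q ⟩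
        2 * (d * Q) + 2 * d ∎
        where
        gather : ∀ d a N → d * a + 2 * (d * N) ≡ d * (a + 2 * N)
        gather = solve-∀
        distribute : ∀ d Q → d * (2 * Q + 2) ≡ 2 * (d * Q) + 2 * d
        distribute = solve-∀

    independent-bound : ∀ {x us} → Unique us → All (x ∼_) us → Independent us →
                        length us * suc l ≤ cSum x us + k
    independent-bound {x} {us} us! x∼us us-indep = *-cancelˡ-≤ 2 (begin
      2 * (length us * suc l)             ≡⟨ expand (length us) l ⟩
      length us * 2 + 2 * (length us * l) ≤⟨ +-monoˡ-≤ _ members ⟩
      ∑ (defect x us) + 2 * (length us * l) ≡⟨ ∑-defect x∼us ⟩
      2 * cSum x us + 2 * k               ≡⟨ *-distribˡ-+ 2 (cSum x us) k ⟨
      2 * (cSum x us + k)                 ∎)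
      where
      open ≤-Reasoning
      expand : ∀ m l → 2 * (m * suc l) ≡ m * 2 + 2 * (m * l)
      expand = solve-∀
      members : length us * 2 ≤ ∑ (defect x us)
      members = ≤-trans (≤-reflexive (sym (defect-independent x∼us us-indep))) (sum-map≤∑ us! (defect x us))

  module QuadrangleConfiguration (srg : IsSRG G 270 105 27) {x u y v w₁ w₂ : Fin n}
    (x≢y : x ≢ y) (u≢v : u ≢ v)
    (x∼u : x ∼ u) (u∼y : u ∼ y) (y∼v : y ∼ v) (v∼x : v ∼ x) (x≁y : ¬ x ∼ y) (u≁v : ¬ u ∼ v)
    (x∼w₁ : x ∼ w₁) (x∼w₂ : x ∼ w₂)
    (u≢w₁ : u ≢ w₁) (u≢w₂ : u ≢ w₂) (v≢w₁ : v ≢ w₁) (v≢w₂ : v ≢ w₂) (w₁≢w₂ : w₁ ≢ w₂)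
    (u≁w₁ : ¬ u ∼ w₁) (u≁w₂ : ¬ u ∼ w₂) (v≁w₁ : ¬ v ∼ w₁) (v≁w₂ : ¬ v ∼ w₂) (w₁≁w₂ : ¬ w₁ ∼ w₂)
    where

    c : Fin n → Fin n → ℕ
    c = cx x

    U : List (Fin n)
    U = u ∷ v ∷ w₁ ∷ w₂ ∷ []

    others : List ℕ
    others = c u w₁ ∷ c u w₂ ∷ c v w₁ ∷ c v w₂ ∷ c w₁ w₂ ∷ []

    S : ℕ
    S = c u v + c u w₁ + c u w₂ + c v w₁ + c v w₂ + c w₁ w₂

    x∼U : All (x ∼_) U
    x∼U = x∼u ∷ ∼-sym v∼x ∷ x∼w₁ ∷ x∼w₂ ∷ []

    U! : Unique U
    U! = (u≢v ∷ u≢w₁ ∷ u≢w₂ ∷ []) ∷ (v≢w₁ ∷ v≢w₂ ∷ []) ∷ (w₁≢w₂ ∷ []) ∷ [] ∷ []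

    U-independent : Independent U
    U-independent = (u≁v ∷ u≁w₁ ∷ u≁w₂ ∷ []) ∷ (v≁w₁ ∷ v≁w₂ ∷ []) ∷ (w₁≁w₂ ∷ []) ∷ [] ∷ []

    c≤26 : ∀ {a b} → a ≢ b → ¬ a ∼ b → x ∼ a → x ∼ b → c a b ≤ 26
    c≤26 a≢b a≁b x∼a x∼b = ≤-pred (cx<μ srg a≢b a≁b x∼a x∼b)

    c-uv≤25 : c u v ≤ 25
    c-uv≤25 = +-cancelʳ-≤ 2 (c u v) 25 (cx+2≤μ srg u≢v u≁v x∼u (∼-sym v∼x) x≢y x≁y u∼y (∼-sym y∼v))

    others≤26 : All (_≤ 26) others
    others≤26 = c≤26 u≢w₁ u≁w₁ x∼u x∼w₁ ∷ c≤26 u≢w₂ u≁w₂ x∼u x∼w₂ ∷ c≤26 v≢w₁ v≁w₁ (∼-sym v∼x) x∼w₁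
              ∷ c≤26 v≢w₂ v≁w₂ (∼-sym v∼x) x∼w₂ ∷ c≤26 w₁≢w₂ w₁≁w₂ x∼w₁ x∼w₂ ∷ []

    S≡c-uv+others : S ≡ c u v + sum others
    S≡c-uv+others = regroup (c u v) (c u w₁) (c u w₂) (c v w₁) (c v w₂) (c w₁ w₂)
      where
      regroup : ∀ a b c d e f → a + b + c + d + e + f ≡ a + (b + (c + (d + (e + (f + 0)))))
      regroup = solve-∀

    cSum≡S : cSum x U ≡ S
    cSum≡S = regroup (c u v) (c u w₁) (c u w₂) (c v w₁) (c v w₂) (c w₁ w₂)
      where
      regroup : ∀ a b c d e f → (a + (b + (c + 0))) + ((d + (e + 0)) + ((f + 0) + (0 + 0))) ≡ a + b + c + d + e + f
      regroup = solve-∀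

    S≤155 : S ≤ 155
    S≤155 = subst (_≤ 155) (sym S≡c-uv+others) (+-mono-≤ c-uv≤25 (sum≤length* others≤26))

    F : Vector ℕ n
    F = defect x U

    excess : ℕ
    excess = ∑ (erase U F)

    excess+308≡2S : excess + 308 ≡ 2 * S
    excess+308≡2S = +-cancelʳ-≡ 540 _ _ (begin
      excess + 308 + 540           ≡⟨ shift excess ⟩
      8 + excess + 840             ≡⟨ cong (λ s → s + excess + 840) (defect-independent x∼U U-independent) ⟨
      sum (map F U) + excess + 840 ≡⟨ cong (_+ 840) (∑-erase U! F) ⟨
      ∑ F + 840                    ≡⟨ ∑-defect srg x∼U ⟩
      2 * cSum x U + 540           ≡⟨ cong (λ s → 2 * s + 540) cSum≡S ⟩
      2 * S + 540                  ∎)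
      where
      open ≡-Reasoning
      shift : ∀ e → e + 308 + 540 ≡ 8 + e + 840
      shift = solve-∀

    S-cases : S ≡ 154 ⊎ S ≡ 155
    S-cases with m≤n⇒m<n∨m≡n S≤155
    ... | inj₂ S≡155 = inj₂ S≡155
    ... | inj₁ S<155 = inj₁ (≤-antisym (≤-pred S<155)
                                       (*-cancelˡ-≤ 2 (≤-trans (m≤n+m 308 excess) (≤-reflexive excess+308≡2S))))

    excess≡0 : S ≡ 154 → excess ≡ 0
    excess≡0 S≡154 = +-cancelʳ-≡ 308 excess 0 (trans excess+308≡2S (cong (2 *_) S≡154))

    excess≡2 : S ≡ 155 → excess ≡ 2
    excess≡2 S≡155 = +-cancelʳ-≡ 308 excess 2 (trans excess+308≡2S (cong (2 *_) S≡155))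

    3≤nbrsIn⇒∉U : ∀ {z} → 3 ≤ nbrsIn z U → z ∉ U
    3≤nbrsIn⇒∉U 3≤N z∈U with () ← subst (3 ≤_) (nbrsIn≡0 (Independent⇒All≁ U-independent z∈U)) 3≤N

    excess-at : ∀ {z} → x ∼ z → z ∉ U → erase U F z ≡ φ (nbrsIn z U)
    excess-at x∼z z∉U = trans (erase-∉ U F z∉U) (defect-Δ U x∼z)

    2≤excess-at : ∀ {z} → x ∼ z → 3 ≤ nbrsIn z U → 2 ≤ erase U F z
    2≤excess-at x∼z 3≤N = subst (2 ≤_) (sym (excess-at x∼z (3≤nbrsIn⇒∉U 3≤N))) (2≤φ 3≤N)

    nbrsIn≢0 : ∀ {z} → x ∼ z → z ∉ U → nbrsIn z U ≢ 0
    nbrsIn≢0 {z} x∼z z∉U N≡0 = <-irrefl refl (begin-strict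
      530                                ≤⟨ independent-bound srg {x} {z ∷ U} (z≢U ∷ U!) (x∼z ∷ x∼U) (z≁U ∷ U-independent) ⟩
      sum (map (c z) U) + cSum x U + 270 ≤⟨ +-monoˡ-≤ 270 (+-mono-≤ (sum≤length* (map⁺ c-zU≤26)) cSum≤155) ⟩
      529                                <⟨ n<1+n 529 ⟩
      530                                ∎)
      where
      open ≤-Reasoning
      z≢U : All (z ≢_) U
      z≢U = ¬Any⇒All¬ U z∉U
      z≁U : All (λ a → ¬ z ∼ a) U
      z≁U = countP≡0⇒All¬ (z ∼?_) U N≡0
      cSum≤155 : cSum x U ≤ 155
      cSum≤155 = ≤-trans (≤-reflexive cSum≡S) S≤155
      c-zU≤26 : All (λ a → c z a ≤ 26) U
      c-zU≤26 = All.tabulate λ a∈U →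
        c≤26 (All.lookup z≢U a∈U) (All.lookup z≁U a∈U) x∼z (All.lookup x∼U a∈U)

    at-most-two : S ≡ 154 → ∀ z → x ∼ z → nbrsIn z U ≤ 2
    at-most-two S≡154 z x∼z = ≮⇒≥ λ 2<N → from-no (2 ≤? 0) (≤-trans
      (2≤excess-at x∼z 2<N) (≤-trans (≤-∑ (erase U F) z) (≤-reflexive (excess≡0 S≡154))))

    unique-three : S ≡ 155 → ∃[ z ] (x ∼ z × nbrsIn z U ≡ 3 × (∀ z′ → x ∼ z′ → z′ ≢ z → nbrsIn z′ U ≤ 2))
    unique-three S≡155 = z , x∼z , N≡3 , others-at-most-two
      where
      positive : ∃[ z ] 0 < erase U F z
      positive = ∑-pos⇒∃ (erase U F) (subst (0 <_) (sym (excess≡2 S≡155)) (s≤s z≤n))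
      z : Fin n
      z = proj₁ positive
      z∉U : z ∉ U
      z∉U z∈U = <-irrefl (sym (erase-∈ U F z∈U)) (proj₂ positive)
      defect-z : x ∼ z × 0 < φ (nbrsIn z U)
      defect-z = defect-pos U (subst (0 <_) (erase-∉ U F z∉U) (proj₂ positive))
      x∼z : x ∼ z
      x∼z = proj₁ defect-z
      3≤N : 3 ≤ nbrsIn z U
      3≤N = [ (λ N≡0 → ⊥-elim (nbrsIn≢0 x∼z z∉U N≡0)) , id ]′ (φ-pos _ (proj₂ defect-z))
      N≡3 : nbrsIn z U ≡ 3
      N≡3 = ≤-antisym (≮⇒≥ λ 3<N → from-no (6 ≤? 2) (≤-trans
        (subst (6 ≤_) (sym (excess-at x∼z z∉U)) (6≤φ 3<N))
        (≤-trans (≤-∑ (erase U F) z) (≤-reflexive (excess≡2 S≡155))))) 3≤N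
      others-at-most-two : ∀ z′ → x ∼ z′ → z′ ≢ z → nbrsIn z′ U ≤ 2
      others-at-most-two z′ x∼z′ z′≢z = ≮⇒≥ λ 2<N′ → from-no (4 ≤? 2) (≤-trans
        (+-mono-≤ (2≤excess-at x∼z 3≤N) (+-monoˡ-≤ 0 (2≤excess-at x∼z′ 2<N′)))
        (≤-trans (sum-map≤∑ (((z′≢z ∘ sym) ∷ []) ∷ [] ∷ []) (erase U F)) (≤-reflexive (excess≡2 S≡155))))

    c-values-155 : S ≡ 155 → c u v ≡ 25 × countP (_≟ 26) others ≡ 5
    c-values-155 S≡155 =
      let c-uv≡25 , others≡130 = +-tight c-uv≤25 (sum≤length* others≤26) (trans (sym S≡c-uv+others) S≡155)
      in c-uv≡25 , countP-all (_≟ 26) (sum≡length*⇒All≡ others≤26 others≡130)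

    c-values-154 : S ≡ 154 → (c u v ≡ 24 × countP (_≟ 26) others ≡ 5)
                           ⊎ (c u v ≡ 25 × countP (_≟ 25) others ≡ 1 × countP (_≟ 26) others ≡ 4)
    c-values-154 S≡154 =
      [ (λ (c-uv≡25 , others≡129) → let one , four = suc-sum≡length*⇒ others≤26 others≡129 in
                                      inj₂ (c-uv≡25 , one , suc-injective four))
      , (λ (c-uv≡24 , others≡130) → inj₁ (suc-injective c-uv≡24 ,
                                      countP-all (_≟ 26) (sum≡length*⇒All≡ others≤26 others≡130)))
      ]′ (+-tight-but-one c-uv≤25 (sum≤length* others≤26) (cong suc (trans (sym S≡c-uv+others) S≡154)))

    conclusion : ((c u v ≡ 24 ⊎ c u v ≡ 25) × (S ≡ 154 ⊎ S ≡ 155))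
               × ( ( (c u v ≡ 24 ⊎ c u v ≡ 25) × S ≡ 154
                   × ( (c u v ≡ 24 × countP (_≟ 26) others ≡ 5)
                     ⊎ (c u v ≡ 25 × countP (_≟ 25) others ≡ 1 × countP (_≟ 26) others ≡ 4))
                   × (∀ z → x ∼ z → nbrsIn z U ≤ 2))
                 ⊎ ( c u v ≡ 25 × S ≡ 155 × countP (_≟ 26) others ≡ 5
                   × ∃[ z ] (x ∼ z × nbrsIn z U ≡ 3 × (∀ z′ → x ∼ z′ → z′ ≢ z → nbrsIn z′ U ≤ 2))))
    conclusion = [ (λ S≡154 → let c-uv = Sum.map proj₁ proj₁ (c-values-154 S≡154) in
                     (c-uv , inj₁ S≡154) , inj₁ (c-uv , S≡154 , c-values-154 S≡154 , at-most-two S≡154))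
                 , (λ S≡155 → let c-uv≡25 , five = c-values-155 S≡155 in
                     (inj₂ c-uv≡25 , inj₂ S≡155) , inj₂ (c-uv≡25 , S≡155 , five , unique-three S≡155))
                 ]′ S-cases

lemma4p3 : (G : SimpleGraph 1911) → IsSRG G 270 105 27 →
    let open SimpleGraph G in
    (x u y v w₁ w₂ : Fin 1911) →
    -- induced quadrangle x ∼ u ∼ y ∼ v ∼ x
    x ≢ u → x ≢ y → x ≢ v → u ≢ y → u ≢ v → y ≢ v →
    x ∼ u → u ∼ y → y ∼ v → v ∼ x → ¬ (x ∼ y) → ¬ (u ∼ v) →
    -- U = {u, v, w₁, w₂} independent of size 4 in Δ(x)
    x ∼ w₁ → x ∼ w₂ →
    u ≢ w₁ → u ≢ w₂ → v ≢ w₁ → v ≢ w₂ → w₁ ≢ w₂ →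
    ¬ (u ∼ w₁) → ¬ (u ∼ w₂) → ¬ (v ∼ w₁) → ¬ (v ∼ w₂) → ¬ (w₁ ∼ w₂) →
    let c = cx x
        U = u ∷ v ∷ w₁ ∷ w₂ ∷ []
        others = c u w₁ ∷ c u w₂ ∷ c v w₁ ∷ c v w₂ ∷ c w₁ w₂ ∷ []
        S = c u v + c u w₁ + c u w₂ + c v w₁ + c v w₂ + c w₁ w₂
    in ((c u v ≡ 24 ⊎ c u v ≡ 25) × (S ≡ 154 ⊎ S ≡ 155))
       × ( -- case (1)
           ( (c u v ≡ 24 ⊎ c u v ≡ 25) × S ≡ 154
           × ( (c u v ≡ 24 × countP (_≟ 26) others ≡ 5)
             ⊎ (c u v ≡ 25 × countP (_≟ 25) others ≡ 1 × countP (_≟ 26) others ≡ 4))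
           × (∀ z → x ∼ z → nbrsIn z U ≤ 2))
         ⊎ -- case (2)
           ( c u v ≡ 25 × S ≡ 155 × countP (_≟ 26) others ≡ 5
           × ∃[ z ] (x ∼ z × nbrsIn z U ≡ 3
                     × (∀ z′ → x ∼ z′ → z′ ≢ z → nbrsIn z′ U ≤ 2))))
lemma4p3 G srg x u y v w₁ w₂ _ x≢y _ _ u≢v _ x∼u u∼y y∼v v∼x x≁y u≁v x∼w₁ x∼w₂
         u≢w₁ u≢w₂ v≢w₁ v≢w₂ w₁≢w₂ u≁w₁ u≁w₂ v≁w₁ v≁w₂ w₁≁w₂ =
  QuadrangleConfiguration.conclusion G srg x≢y u≢v x∼u u∼y y∼v v∼x x≁y u≁v x∼w₁ x∼w₂
    u≢w₁ u≢w₂ v≢w₁ v≢w₂ w₁≢w₂ u≁w₁ u≁w₂ v≁w₁ v≁w₂ w₁≁w₂
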